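{- Consider an Unbounded Knapsack instance with weights $w_1,\dots,w_n$ and integer profits $p_1,\dots,p_n$. Let $\sigma$ be any lexical order, $j\in[1,t]$ a feasible target, and $x\in\mathsf{supp}(\mathsf{sol}(j,\sigma))$. Write $\mathsf{sol}(j,\sigma)=(u_1,\dots,u_n)$ and define $v=(v_1,\dots,v_n)$ by $v_k=u_k$ for $k\ne x$ and $v_x=u_x-1$. Then $\mathsf{sol}(j-w_x,\sigma)=v$.
   Context: A solution to a sum $c$ is $m\in\mathbb{N}^n$ with $\sum_i w_im_i=c$; $c$ is feasible if one exists. Its value is $\sum_i p_im_i$, and a solution is optimal if it has maximum value among solutions to the same sum. $\mathsf{supp}(m)=\{i\mid m_i>0\}$. A lexical order $\sigma$ is a permutation of $\{1,\dots,n\}$; solution $A$ is lexicographically smaller than $B$ under $\sigma$ if there is $j$ with $a_{\sigma_k}=b_{\sigma_k}$ for all $k<j$ and $a_{\sigma_j}>b_{\sigma_j}$. $\mathsf{sol}(j,\sigma)$ is the lexicographically smallest (under $\sigma$) optimal solution to $j$. -}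

module Defs where

open import Data.Nat as ℕ using (ℕ; zero; suc; _∸_)
open import Data.Integer as ℤ using (ℤ; +_)
open import Data.Fin using (Fin; zero; suc; _<_; _≟_)
open import Data.Fin.Permutation using (Permutation′; _⟨$⟩ʳ_)
open import Data.Product using (Σ; ∃; _×_)
open import Relation.Binary.PropositionalEquality using (_≡_)
open import Relation.Nullary using (¬_; yes; no)

-- An Unbounded Knapsack instance with n items: positive weights w_i, integer profits p_i.
-- (Positivity of weights is a standing requirement; it is a separate hypothesis in lemma9.)

Vector : ℕ → Set
Vector n = Fin n → ℕ

sumℕ : ∀ {n} → (Fin n → ℕ) → ℕ
sumℕ {zero}  f = 0
sumℕ {suc n} f = f zero ℕ.+ sumℕ (λ i → f (suc i))

sumℤ : ∀ {n} → (Fin n → ℤ) → ℤ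
sumℤ {zero}  f = + 0
sumℤ {suc n} f = f zero ℤ.+ sumℤ (λ i → f (suc i))

module Knapsack {n : ℕ} (w : Fin n → ℕ) (p : Fin n → ℤ) where

  IsSolution : ℕ → Vector n → Set
  IsSolution c m = sumℕ (λ i → w i ℕ.* m i) ≡ c

  Feasible : ℕ → Set
  Feasible c = ∃ λ m → IsSolution c m

  value : Vector n → ℤ
  value m = sumℤ (λ i → p i ℤ.* + (m i))

  IsOptimal : ℕ → Vector n → Set
  IsOptimal c m = IsSolution c m × (∀ m′ → IsSolution c m′ → value m′ ℤ.≤ value m)

  LexLt : Permutation′ n → Vector n → Vector n → Set
  LexLt σ a b = Σ (Fin n) λ j →
    (∀ k → k < j → a (σ ⟨$⟩ʳ k) ≡ b (σ ⟨$⟩ʳ k)) × (b (σ ⟨$⟩ʳ j) ℕ.< a (σ ⟨$⟩ʳ j))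

  IsSol : ℕ → Permutation′ n → Vector n → Set
  IsSol c σ m = IsOptimal c m × (∀ m′ → IsOptimal c m′ → ¬ LexLt σ m′ m)

  InSupp : Fin n → Vector n → Set
  InSupp x m = 0 ℕ.< m x

  removeOne : Fin n → Vector n → Vector n
  removeOne x u k with k ≟ x
  ... | yes _ = u x ∸ 1
  ... | no  _ = u k

{-# OPTIONS --safe #-}
module Submission where

-- Adding one copy of item x sends solutions of c to solutions of c + w x, raises every value by
-- the same p x and preserves the lexicographic order.  So if sol(j, σ) = v + e_x, then v is an
-- optimal solution of j − w x, and an optimal solution of j − w x lexicographically smaller than
-- v would, after adding e_x, be an optimal solution of j lexicographically smaller than sol(j, σ).

open import Defs
open import Data.Nat using (ℕ; _∸_; _≤_; _<_)
open import Data.Integer using (ℤ)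
open import Data.Fin using (Fin)
open import Data.Fin.Permutation using (Permutation′)

import Data.Nat as ℕ
import Data.Nat.Properties as ℕ
import Data.Integer as ℤ
import Data.Integer.Properties as ℤ
open import Algebra.Properties.CommutativeSemigroup ℕ.+-commutativeSemigroup
  using () renaming (interchange to ℕ-+-interchange)
open import Algebra.Properties.CommutativeSemigroup ℤ.+-commutativeSemigroup
  using () renaming (interchange to ℤ-+-interchange)
open import Data.Fin using (zero; suc; _≟_)
open import Data.Product using (_,_)
open import Data.Empty using (⊥-elim)
open import Function using (_∘_)
open import Relation.Binary.PropositionalEquality
open import Relation.Nullary using (yes; no; ¬_)

δ : ∀ {n} → Fin n → Fin n → ℕ
δ zero    zero    = 1
δ zero    (suc _) = 0
δ (suc _) zero    = 0
δ (suc x) (suc k) = δ x k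

δ-diag : ∀ {n} (x : Fin n) → δ x x ≡ 1
δ-diag zero    = refl
δ-diag (suc x) = δ-diag x

δ-offdiag : ∀ {n} {x k : Fin n} → k ≢ x → δ x k ≡ 0
δ-offdiag {x = zero}  {zero}  k≢x = ⊥-elim (k≢x refl)
δ-offdiag {x = zero}  {suc k} k≢x = refl
δ-offdiag {x = suc x} {zero}  k≢x = refl
δ-offdiag {x = suc x} {suc k} k≢x = δ-offdiag (k≢x ∘ cong suc)

sumℕ-cong : ∀ {n} {f g : Fin n → ℕ} → (∀ i → f i ≡ g i) → sumℕ f ≡ sumℕ g
sumℕ-cong {ℕ.zero}  f≗g = refl
sumℕ-cong {ℕ.suc n} f≗g = cong₂ ℕ._+_ (f≗g zero) (sumℕ-cong (f≗g ∘ suc))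

sumℤ-cong : ∀ {n} {f g : Fin n → ℤ} → (∀ i → f i ≡ g i) → sumℤ f ≡ sumℤ g
sumℤ-cong {ℕ.zero}  f≗g = refl
sumℤ-cong {ℕ.suc n} f≗g = cong₂ ℤ._+_ (f≗g zero) (sumℤ-cong (f≗g ∘ suc))

sumℕ-+ : ∀ {n} (f g : Fin n → ℕ) → sumℕ (λ i → f i ℕ.+ g i) ≡ sumℕ f ℕ.+ sumℕ g
sumℕ-+ {ℕ.zero}  f g = refl
sumℕ-+ {ℕ.suc n} f g = trans (cong ((f zero ℕ.+ g zero) ℕ.+_) (sumℕ-+ (f ∘ suc) (g ∘ suc)))
  (ℕ-+-interchange (f zero) (g zero) (sumℕ (f ∘ suc)) (sumℕ (g ∘ suc)))

sumℤ-+ : ∀ {n} (f g : Fin n → ℤ) → sumℤ (λ i → f i ℤ.+ g i) ≡ sumℤ f ℤ.+ sumℤ g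
sumℤ-+ {ℕ.zero}  f g = refl
sumℤ-+ {ℕ.suc n} f g = trans (cong (ℤ._+_ (f zero ℤ.+ g zero)) (sumℤ-+ (f ∘ suc) (g ∘ suc)))
  (ℤ-+-interchange (f zero) (g zero) (sumℤ (f ∘ suc)) (sumℤ (g ∘ suc)))

sumℕ-zero : ∀ n → sumℕ {n} (λ _ → 0) ≡ 0
sumℕ-zero ℕ.zero    = refl
sumℕ-zero (ℕ.suc n) = sumℕ-zero n

sumℤ-zero : ∀ n → sumℤ {n} (λ _ → ℤ.0ℤ) ≡ ℤ.0ℤ
sumℤ-zero ℕ.zero    = refl
sumℤ-zero (ℕ.suc n) = trans (ℤ.+-identityˡ _) (sumℤ-zero n)

sumℕ-*δ : ∀ {n} (f : Fin n → ℕ) (x : Fin n) → sumℕ (λ i → f i ℕ.* δ x i) ≡ f x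
sumℕ-*δ {ℕ.suc n} f zero = begin
  f zero ℕ.* 1 ℕ.+ sumℕ (λ i → f (suc i) ℕ.* 0)
    ≡⟨ cong₂ ℕ._+_ (ℕ.*-identityʳ (f zero)) (sumℕ-cong (ℕ.*-zeroʳ ∘ f ∘ suc)) ⟩
  f zero ℕ.+ sumℕ {n} (λ _ → 0)
    ≡⟨ cong (f zero ℕ.+_) (sumℕ-zero n) ⟩
  f zero ℕ.+ 0
    ≡⟨ ℕ.+-identityʳ (f zero) ⟩
  f zero ∎
  where open ≡-Reasoning
sumℕ-*δ f (suc x) = cong₂ ℕ._+_ (ℕ.*-zeroʳ (f zero)) (sumℕ-*δ (f ∘ suc) x)

sumℤ-*δ : ∀ {n} (f : Fin n → ℤ) (x : Fin n) → sumℤ (λ i → f i ℤ.* ℤ.+ δ x i) ≡ f x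
sumℤ-*δ {ℕ.suc n} f zero = begin
  f zero ℤ.* ℤ.1ℤ ℤ.+ sumℤ (λ i → f (suc i) ℤ.* ℤ.0ℤ)
    ≡⟨ cong₂ ℤ._+_ (ℤ.*-identityʳ (f zero)) (sumℤ-cong (ℤ.*-zeroʳ ∘ f ∘ suc)) ⟩
  f zero ℤ.+ sumℤ {n} (λ _ → ℤ.0ℤ)
    ≡⟨ cong (ℤ._+_ (f zero)) (sumℤ-zero n) ⟩
  f zero ℤ.+ ℤ.0ℤ
    ≡⟨ ℤ.+-identityʳ (f zero) ⟩
  f zero ∎
  where open ≡-Reasoning
sumℤ-*δ f (suc x) = trans (cong₂ ℤ._+_ (ℤ.*-zeroʳ (f zero)) (sumℤ-*δ (f ∘ suc) x))
  (ℤ.+-identityˡ (f (suc x)))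

ℤ-+-cancelʳ-≤ : ∀ {a b} c → a ℤ.+ c ℤ.≤ b ℤ.+ c → a ℤ.≤ b
ℤ-+-cancelʳ-≤ {a} {b} c a+c≤b+c =
  subst₂ ℤ._≤_ (+-−-cancel a) (+-−-cancel b) (ℤ.+-monoˡ-≤ (ℤ.- c) a+c≤b+c)
  where
  +-−-cancel : ∀ y → y ℤ.+ c ℤ.- c ≡ y
  +-−-cancel y = trans (ℤ.+-assoc y c (ℤ.- c))
    (trans (cong (ℤ._+_ y) (ℤ.+-inverseʳ c)) (ℤ.+-identityʳ y))

addOne : ∀ {n} → Fin n → Vector n → Vector n
addOne x m k = m k ℕ.+ δ x k

module _ {n : ℕ} (w : Fin n → ℕ) (p : Fin n → ℤ) where
  open Knapsack w p

  weight : Vector n → ℕ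
  weight m = sumℕ (λ i → w i ℕ.* m i)

  weight-cong : ∀ {m m′} → (∀ k → m k ≡ m′ k) → weight m ≡ weight m′
  weight-cong m≗m′ = sumℕ-cong (λ i → cong (w i ℕ.*_) (m≗m′ i))

  value-cong : ∀ {m m′} → (∀ k → m k ≡ m′ k) → value m ≡ value m′
  value-cong m≗m′ = sumℤ-cong (λ i → cong (λ z → p i ℤ.* ℤ.+ z) (m≗m′ i))

  weight-addOne : ∀ x m → weight (addOne x m) ≡ weight m ℕ.+ w x
  weight-addOne x m = begin
    sumℕ (λ i → w i ℕ.* (m i ℕ.+ δ x i))
      ≡⟨ sumℕ-cong (λ i → ℕ.*-distribˡ-+ (w i) (m i) (δ x i)) ⟩
    sumℕ (λ i → w i ℕ.* m i ℕ.+ w i ℕ.* δ x i)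
      ≡⟨ sumℕ-+ (λ i → w i ℕ.* m i) (λ i → w i ℕ.* δ x i) ⟩
    weight m ℕ.+ sumℕ (λ i → w i ℕ.* δ x i)
      ≡⟨ cong (weight m ℕ.+_) (sumℕ-*δ w x) ⟩
    weight m ℕ.+ w x ∎
    where open ≡-Reasoning

  value-addOne : ∀ x m → value (addOne x m) ≡ value m ℤ.+ p x
  value-addOne x m = begin
    sumℤ (λ i → p i ℤ.* ℤ.+ (m i ℕ.+ δ x i))
      ≡⟨ sumℤ-cong (λ i → cong (p i ℤ.*_) (ℤ.pos-+ (m i) (δ x i))) ⟩
    sumℤ (λ i → p i ℤ.* (ℤ.+ m i ℤ.+ ℤ.+ δ x i))
      ≡⟨ sumℤ-cong (λ i → ℤ.*-distribˡ-+ (p i) (ℤ.+ m i) (ℤ.+ δ x i)) ⟩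
    sumℤ (λ i → p i ℤ.* ℤ.+ m i ℤ.+ p i ℤ.* ℤ.+ δ x i)
      ≡⟨ sumℤ-+ (λ i → p i ℤ.* ℤ.+ m i) (λ i → p i ℤ.* ℤ.+ δ x i) ⟩
    value m ℤ.+ sumℤ (λ i → p i ℤ.* ℤ.+ δ x i)
      ≡⟨ cong (ℤ._+_ (value m)) (sumℤ-*δ p x) ⟩
    value m ℤ.+ p x ∎
    where open ≡-Reasoning

  addOne-removeOne : ∀ x u → InSupp x u → ∀ k → addOne x (removeOne x u) k ≡ u k
  addOne-removeOne x u 0<ux k with k ≟ x
  ... | yes refl = trans (cong (u x ∸ 1 ℕ.+_) (δ-diag x)) (ℕ.m∸n+n≡m 0<ux)
  ... | no  k≢x  = trans (cong (u k ℕ.+_) (δ-offdiag k≢x)) (ℕ.+-identityʳ (u k))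

  LexLt-addOne : ∀ σ x {a b} → LexLt σ a b → LexLt σ (addOne x a) (addOne x b)
  LexLt-addOne σ x (j , a≡b , b<a) =
    j , (λ k k<j → cong (ℕ._+ δ x _) (a≡b k k<j)) , ℕ.+-monoˡ-< (δ x _) b<a

  LexLt-congʳ : ∀ σ {a b b′} → (∀ k → b k ≡ b′ k) → LexLt σ a b → LexLt σ a b′
  LexLt-congʳ σ {a} b≗b′ (j , a≡b , b<a) =
    j , (λ k k<j → trans (a≡b k k<j) (b≗b′ _)) , subst (ℕ._< a _) (b≗b′ _) b<a

  IsSolution-addOne : ∀ {c} x {m} → IsSolution c m → IsSolution (c ℕ.+ w x) (addOne x m)
  IsSolution-addOne x {m} m-sol = trans (weight-addOne x m) (cong (ℕ._+ w x) m-sol)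

  IsSol-addOne⁻¹ : ∀ {c σ x v u} → (∀ k → addOne x v k ≡ u k) →
                   IsSol (c ℕ.+ w x) σ u → IsSol c σ v
  IsSol-addOne⁻¹ {c} {σ} {x} {v} {u} v+x≗u ((u-sol , u-max) , u-least) =
    (v-sol , v-max) , v-least
    where
    value-u : value u ≡ value v ℤ.+ p x
    value-u = trans (sym (value-cong v+x≗u)) (value-addOne x v)

    v-sol : IsSolution c v
    v-sol = ℕ.+-cancelʳ-≡ (w x) (weight v) c
      (trans (sym (weight-addOne x v)) (trans (weight-cong v+x≗u) u-sol))

    v-max : ∀ m → IsSolution c m → value m ℤ.≤ value v
    v-max m m-sol = ℤ-+-cancelʳ-≤ (p x)
      (subst₂ ℤ._≤_ (value-addOne x m) value-u (u-max (addOne x m) (IsSolution-addOne x m-sol)))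

    v-least : ∀ m → IsOptimal c m → ¬ LexLt σ m v
    v-least m (m-sol , m-max) m<v =
      u-least (addOne x m) (IsSolution-addOne x m-sol , m+x-max)
        (LexLt-congʳ σ {addOne x m} v+x≗u (LexLt-addOne σ x {m} {v} m<v))
      where
      m+x-max : ∀ m′ → IsSolution (c ℕ.+ w x) m′ → value m′ ℤ.≤ value (addOne x m)
      m+x-max m′ m′-sol = ℤ.≤-trans (u-max m′ m′-sol)
        (subst₂ ℤ._≤_ (sym value-u) (sym (value-addOne x m))
          (ℤ.+-monoˡ-≤ (p x) (m-max v v-sol)))

lemma9 : (n : ℕ) (w : Fin n → ℕ) (p : Fin n → ℤ) → (∀ i → 0 < w i)
       → (σ : Permutation′ n) (t j : ℕ) → 1 ≤ j → j ≤ t → Knapsack.Feasible w p j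
       → (u : Vector n) → Knapsack.IsSol w p j σ u
       → (x : Fin n) → Knapsack.InSupp w p x u
       → Knapsack.IsSol w p (j ∸ w x) σ (Knapsack.removeOne w p x u)
lemma9 n w p _ σ t j _ _ _ u u-sol@((weight-u , _) , _) x 0<ux =
  subst (λ c → IsSol c σ v) (sym j∸wx≡weight-v)
    (IsSol-addOne⁻¹ w p {σ = σ} v+x≗u (subst (λ c → IsSol c σ u) j≡weight-v+wx u-sol))
  where
  open Knapsack w p
  v : Vector n
  v = removeOne x u

  v+x≗u : ∀ k → addOne x v k ≡ u k
  v+x≗u = addOne-removeOne w p x u 0<ux

  j≡weight-v+wx : j ≡ weight w p v ℕ.+ w x
  j≡weight-v+wx = trans (sym weight-u)
    (trans (sym (weight-cong w p v+x≗u)) (weight-addOne w p x v))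

  j∸wx≡weight-v : j ∸ w x ≡ weight w p v
  j∸wx≡weight-v = trans (cong (_∸ w x) j≡weight-v+wx) (ℕ.m+n∸n≡m (weight w p v) (w x))
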